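{- Let $n=2r$ and let $M$ be the $n\times n$ Latin square defined below. Then each cell of $M$ belongs to exactly $r$ distinct strong intercalates.
   Context: Let $M_{11}$ be the $r\times r$ cyclic Latin square with $M_{11}(i,j)=j-i+1$ taken modulo $r$ (with values in $\{1,\dots,r\}$); let $M_{12}(i,j)=M_{11}(i,j)+r$; let $M_{21}=M_{12}^{T}$ and $M_{22}=M_{11}^{T}$. $M$ is the $2r\times 2r$ Latin square with $M_{11}$ in its upper-left $r\times r$ block, $M_{12}$ upper-right, $M_{21}$ lower-left, $M_{22}$ lower-right. An intercalate in an $n\times n$ Latin square $L$ is a set of cells $\{(r_1,c_1),(r_1,c_2),(r_2,c_1),(r_2,c_2)\}$ with $L(r_1,c_1)=L(r_2,c_2)$ and $L(r_1,c_2)=L(r_2,c_1)$; it is a strong intercalate if moreover exactly one of the symbols $L(r_1,c_1),L(r_1,c_2)$ lies in $\{1,\dots,\lfloor n/2\rfloor\}$. -}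

module Defs where

open import Data.Nat using (ℕ; zero; suc; _+_; _∸_; _≤_; _<?_; _≤?_; NonZero; _/_; _%_)
import Data.Nat.Properties as ℕP
open import Data.Fin using (Fin; toℕ)
import Data.Fin as F
import Data.Fin.Properties as FP
open import Data.List using (List; length; filter; allFin; cartesianProduct; map; concatMap)
open import Data.Product using (_×_; _,_; proj₁; proj₂)
open import Data.Sum using (_⊎_)
open import Relation.Nullary using (¬_; Dec)
open import Relation.Nullary.Decidable using (_×-dec_; _⊎-dec_; ¬?; yes; no)
open import Relation.Binary.PropositionalEquality using (_≡_)
open import Data.Bool using (if_then_else_)
open import Relation.Nullary.Decidable using (does)

-- Rows, columns are indexed 0,…,n-1 (0-based), symbols are 1,…,n.

-- Cyclic Latin square M₁₁ (0-based indices i, j < r):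
-- paper (1-based): M₁₁(i,j) = j - i + 1 mod r with values in {1..r},
-- i.e. 0-based: ((j - i) mod r) + 1 = ((r + j ∸ i) mod r) + 1.
M11 : (r : ℕ) → .{{NonZero r}} → ℕ → ℕ → ℕ
M11 r i j = suc ((r + j ∸ i) % r)

-- The 2r × 2r square M in block form:
--   M₁₂(i,j) = M₁₁(i,j) + r,  M₂₁ = M₁₂ᵀ,  M₂₂ = M₁₁ᵀ.
M : (r : ℕ) → .{{NonZero r}} → Fin (r + r) → Fin (r + r) → ℕ
M r i j with toℕ i <? r | toℕ j <? r
... | yes _ | yes _ = M11 r (toℕ i) (toℕ j)
... | yes _ | no  _ = M11 r (toℕ i) (toℕ j ∸ r) + r
... | no  _ | yes _ = M11 r (toℕ j) (toℕ i ∸ r) + r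
... | no  _ | no  _ = M11 r (toℕ j ∸ r) (toℕ i ∸ r)

-- An intercalate {(r₁,c₁),(r₁,c₂),(r₂,c₁),(r₂,c₂)} is represented canonically
-- by the quadruple (r₁, r₂, c₁, c₂) with r₁ < r₂ and c₁ < c₂; this is a
-- bijection between such quadruples and 2×2 cell sets.
Quad : ℕ → Set
Quad n = Fin n × Fin n × Fin n × Fin n

Intercalate : {n : ℕ} → (Fin n → Fin n → ℕ) → Quad n → Set
Intercalate L (r₁ , r₂ , c₁ , c₂) =
  (r₁ F.< r₂) × (c₁ F.< c₂) × (L r₁ c₁ ≡ L r₂ c₂) × (L r₁ c₂ ≡ L r₂ c₁)

Low : ℕ → ℕ → Set
Low n s = (1 ≤ s) × (s ≤ n / 2)

ExactlyOne : Set → Set → Set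
ExactlyOne P Q = (P × ¬ Q) ⊎ (¬ P × Q)

StrongIntercalate : {n : ℕ} → (Fin n → Fin n → ℕ) → Quad n → Set
StrongIntercalate {n} L q@(r₁ , r₂ , c₁ , c₂) =
  Intercalate L q × ExactlyOne (Low n (L r₁ c₁)) (Low n (L r₁ c₂))

ContainsCell : {n : ℕ} → Fin n → Fin n → Quad n → Set
ContainsCell i j (r₁ , r₂ , c₁ , c₂) = ((i ≡ r₁) ⊎ (i ≡ r₂)) × ((j ≡ c₁) ⊎ (j ≡ c₂))

low? : ∀ n s → Dec (Low n s)
low? n s = (1 ≤? s) ×-dec (s ≤? n / 2)

exactlyOne? : ∀ {P Q : Set} → Dec P → Dec Q → Dec (ExactlyOne P Q)
exactlyOne? p q = (p ×-dec ¬? q) ⊎-dec (¬? p ×-dec q)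

strong? : {n : ℕ} → (L : Fin n → Fin n → ℕ) → (q : Quad n) → Dec (StrongIntercalate L q)
strong? {n} L (r₁ , r₂ , c₁ , c₂) =
  ((r₁ F.<? r₂) ×-dec ((c₁ F.<? c₂) ×-dec ((L r₁ c₁ ℕP.≟ L r₂ c₂) ×-dec (L r₁ c₂ ℕP.≟ L r₂ c₁))))
  ×-dec exactlyOne? (low? n (L r₁ c₁)) (low? n (L r₁ c₂))

contains? : {n : ℕ} → (i j : Fin n) → (q : Quad n) → Dec (ContainsCell i j q)
contains? i j (r₁ , r₂ , c₁ , c₂) =
  ((i FP.≟ r₁) ⊎-dec (i FP.≟ r₂)) ×-dec ((j FP.≟ c₁) ⊎-dec (j FP.≟ c₂))

allQuads : (n : ℕ) → List (Quad n)
allQuads n = cartesianProduct (allFin n)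
               (cartesianProduct (allFin n) (cartesianProduct (allFin n) (allFin n)))

strongCount : {n : ℕ} → (Fin n → Fin n → ℕ) → Fin n → Fin n → ℕ
strongCount {n} L i j =
  length (filter (λ q → strong? L q ×-dec contains? i j q) (allQuads n))

-- An intercalate is strong when its two symbols lie on opposite sides of ⌊n/2⌋ = r. In M the
-- small symbols are exactly those of the diagonal blocks, so a strong intercalate has its first
-- row and column in the top/left half and its second row and column in the bottom/right half,
-- and both of its equations reduce to the single congruence c₁ + (c₂ − r) ≡ r₁ + (r₂ − r)
-- (mod r). For a fixed cell (i , j) the row through i may be paired with any of the r rows of
-- the other half, and then the congruence determines the partner of column j uniquely.
module Submission where

open import Defs
open import Data.Bool using (Bool; true; false)
open import Data.Empty using (⊥-elim)
open import Data.Fin as F using (Fin; toℕ; fromℕ<)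
import Data.Fin.Properties as FP
open import Data.List using (List; []; _∷_; _++_; length; filter; map; allFin; cartesianProduct)
open import Data.List.Properties using (length-++; filter-++; filter-≐; filter-none; map-tabulate)
open import Data.List.Relation.Unary.All using (universal)
open import Data.Nat
  using (ℕ; zero; suc; _+_; _*_; _∸_; _≤_; _<_; z≤n; s≤s; s≤s⁻¹; NonZero; _%_; _/_; _<?_; _≤?_; _≟_)
open import Data.Nat.Properties
open import Data.Nat.DivMod
open import Data.Nat.Tactic.RingSolver using (solve-∀)
open import Data.Product using (_×_; _,_; proj₁; proj₂)
open import Data.Sum using (_⊎_; inj₁; inj₂)
open import Function using (_∘_; id; _⇔_; mk⇔; Equivalence)
import Function.Properties.Equivalence as ⇔
open import Level using (0ℓ)
open import Relation.Nullary using (¬_; yes; no; does; contradiction)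
open import Relation.Nullary.Decidable using (_×-dec_; _⊎-dec_)
open import Relation.Unary using (Pred; Decidable)
open import Relation.Binary.PropositionalEquality

open Equivalence using (to; from)

rowsOf colsOf : ∀ {n} → Quad n → Fin n × Fin n
rowsOf (r₁ , r₂ , _ , _) = r₁ , r₂
colsOf (_ , _ , c₁ , c₂) = c₁ , c₂

exactlyOne⇒¬⇔ : {P Q : Set} → ExactlyOne P Q → ¬ (P ⇔ Q)
exactlyOne⇒¬⇔ (inj₁ (p , ¬q)) P⇔Q = ¬q (to P⇔Q p)
exactlyOne⇒¬⇔ (inj₂ (¬p , q)) P⇔Q = ¬p (from P⇔Q q)

≡⇔≡⇒≡ : ∀ (x y z : Bool) → (x ≡ y ⇔ x ≡ z) → y ≡ z
≡⇔≡⇒≡ true  true  z     h = to h refl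
≡⇔≡⇒≡ false false z     h = to h refl
≡⇔≡⇒≡ true  false true  h = sym (from h refl)
≡⇔≡⇒≡ true  false false h = refl
≡⇔≡⇒≡ false true  false h = sym (from h refl)
≡⇔≡⇒≡ false true  true  h = refl

-- Counting in lists

count : {A : Set} {P : Pred A 0ℓ} → Decidable P → List A → ℕ
count P? = length ∘ filter P?

module _ {A : Set} {P : Pred A 0ℓ} (P? : Decidable P) where

  count-++ : ∀ xs ys → count P? (xs ++ ys) ≡ count P? xs + count P? ys
  count-++ xs ys = trans (cong length (filter-++ P? xs ys)) (length-++ (filter P? xs))

  count-none : (∀ x → ¬ P x) → ∀ xs → count P? xs ≡ 0
  count-none ¬P xs = cong length (filter-none P? (universal ¬P xs))

  count-cong : {Q : Pred A 0ℓ} (Q? : Decidable Q) → (∀ x → P x ⇔ Q x) →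
               ∀ xs → count P? xs ≡ count Q? xs
  count-cong Q? P⇔Q xs =
    cong length (filter-≐ P? Q? ((λ {x} → to (P⇔Q x)) , (λ {x} → from (P⇔Q x))) xs)

count-map : {A B : Set} {P : Pred B 0ℓ} (P? : Decidable P) (f : A → B) →
            ∀ xs → count P? (map f xs) ≡ count (P? ∘ f) xs
count-map P? f []       = refl
count-map P? f (x ∷ xs) with does (P? (f x))
... | true  = cong suc (count-map P? f xs)
... | false = count-map P? f xs

count-cartesianProduct-∷ : {A B : Set} {P : Pred (A × B) 0ℓ} (P? : Decidable P) →
  ∀ x xs ys → count P? (cartesianProduct (x ∷ xs) ys) ≡
              count (λ y → P? (x , y)) ys + count P? (cartesianProduct xs ys)
count-cartesianProduct-∷ P? x xs ys =
  trans (count-++ P? (map (x ,_) ys) (cartesianProduct xs ys))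
        (cong (_+ count P? (cartesianProduct xs ys)) (count-map P? (x ,_) ys))

count-×-fibres : {A B : Set} {X : Pred A 0ℓ} {Z : A → Pred B 0ℓ}
  (X? : Decidable X) (Z? : ∀ x → Decidable (Z x)) {ys : List B} {k : ℕ} →
  (∀ x → count (Z? x) ys ≡ k) →
  ∀ xs → count (λ p → X? (proj₁ p) ×-dec Z? (proj₁ p) (proj₂ p)) (cartesianProduct xs ys)
         ≡ count X? xs * k
count-×-fibres X? Z? fibre [] = refl
count-×-fibres X? Z? {ys} fibre (x ∷ xs)
  rewrite count-cartesianProduct-∷ (λ p → X? (proj₁ p) ×-dec Z? (proj₁ p) (proj₂ p)) x xs ys
  with X? x
... | yes X[x] = cong₂ _+_ (trans (count-cong _ (Z? x) (λ _ → mk⇔ proj₂ (X[x] ,_)) ys) (fibre x))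
                           (count-×-fibres X? Z? fibre xs)
... | no ¬X[x] = cong₂ _+_ (count-none _ (λ _ → ¬X[x] ∘ proj₁) ys) (count-×-fibres X? Z? fibre xs)

count-×-uniqueFibres : {A B C : Set} {X : Pred (A × B) 0ℓ} {Z : A × B → Pred C 0ℓ}
  (X? : Decidable X) (Z? : ∀ p → Decidable (Z p)) {ys : List B} {zs : List C} →
  (∀ p → count (Z? p) zs ≡ 1) →
  ∀ xs → count (λ q → X? (proj₁ q , proj₁ (proj₂ q))
                       ×-dec Z? (proj₁ q , proj₁ (proj₂ q)) (proj₂ (proj₂ q)))
               (cartesianProduct xs (cartesianProduct ys zs))
         ≡ count X? (cartesianProduct xs ys)
count-×-uniqueFibres X? Z? unique [] = refl
count-×-uniqueFibres {X = X} {Z} X? Z? {ys} {zs} unique (x ∷ xs) =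
  begin
    count Q? (cartesianProduct (x ∷ xs) (cartesianProduct ys zs))
  ≡⟨ count-cartesianProduct-∷ Q? x xs (cartesianProduct ys zs) ⟩
    count (λ p → Q? (x , p)) (cartesianProduct ys zs)
      + count Q? (cartesianProduct xs (cartesianProduct ys zs))
  ≡⟨ cong₂ _+_ (trans (count-×-fibres (λ y → X? (x , y)) (λ y → Z? (x , y))
                                      (λ y → unique (x , y)) ys)
                      (*-identityʳ _))
               (count-×-uniqueFibres X? Z? unique xs) ⟩
    count (λ y → X? (x , y)) ys + count X? (cartesianProduct xs ys)
  ≡⟨ count-cartesianProduct-∷ X? x xs ys ⟨
    count X? (cartesianProduct (x ∷ xs) ys)
  ∎
  where
  open ≡-Reasoning
  Q? : Decidable (λ q → X (proj₁ q , proj₁ (proj₂ q))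
                        × Z (proj₁ q , proj₁ (proj₂ q)) (proj₂ (proj₂ q)))
  Q? q = X? (proj₁ q , proj₁ (proj₂ q))
         ×-dec Z? (proj₁ q , proj₁ (proj₂ q)) (proj₂ (proj₂ q))

allFin-suc : ∀ n → allFin (suc n) ≡ F.zero ∷ map F.suc (allFin n)
allFin-suc n = cong (F.zero ∷_) (sym (map-tabulate id F.suc))

count-allFin-suc : ∀ n {P : Pred (Fin (suc n)) 0ℓ} (P? : Decidable P) →
  count P? (allFin (suc n)) ≡ count P? (F.zero ∷ []) + count (P? ∘ F.suc) (allFin n)
count-allFin-suc n P? =
  trans (cong (count P?) (allFin-suc n))
        (trans (count-++ P? (F.zero ∷ []) (map F.suc (allFin n)))
               (cong (count P? (F.zero ∷ []) +_) (count-map P? F.suc (allFin n))))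

count-allFin-≡ : ∀ {n} (i : Fin n) → count (FP._≟ i) (allFin n) ≡ 1
count-allFin-≡ {suc n} F.zero =
  trans (count-allFin-suc n (FP._≟ F.zero))
        (cong suc (count-none (λ c → F.suc c FP.≟ F.zero) (λ _ ()) (allFin n)))
count-allFin-≡ {suc n} (F.suc i) =
  trans (count-allFin-suc n (FP._≟ F.suc i))
        (trans (count-cong (λ c → F.suc c FP.≟ F.suc i) (FP._≟ i)
                           (λ _ → mk⇔ FP.suc-injective (cong F.suc)) (allFin n))
               (count-allFin-≡ i))

count-allFin-toℕ≡ : ∀ {n v} → v < n → count (λ (c : Fin n) → toℕ c ≟ v) (allFin n) ≡ 1
count-allFin-toℕ≡ {n} {v} v<n =
  trans (count-cong (λ c → toℕ c ≟ v) (FP._≟ fromℕ< v<n)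
          (λ _ → mk⇔ (λ e → FP.toℕ-injective (trans e (sym (FP.toℕ-fromℕ< v<n))))
                     (λ { refl → FP.toℕ-fromℕ< v<n }))
          (allFin n))
        (count-allFin-≡ (fromℕ< v<n))

count-allFin-toℕ< : ∀ {n} k → k ≤ n → count (λ (c : Fin n) → toℕ c <? k) (allFin n) ≡ k
count-allFin-toℕ< {n} zero _ = count-none (λ c → toℕ c <? zero) (λ _ ()) (allFin n)
count-allFin-toℕ< {suc n} (suc k) (s≤s k≤n) =
  trans (count-allFin-suc n (λ c → toℕ c <? suc k))
        (cong suc (trans (count-cong (λ c → suc (toℕ c) <? suc k) (λ c → toℕ c <? k)
                                     (λ _ → mk⇔ s≤s⁻¹ s≤s) (allFin n))
                         (count-allFin-toℕ< k k≤n)))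

count-allFin-≤toℕ : ∀ {n} k → count (λ (c : Fin n) → k ≤? toℕ c) (allFin n) ≡ n ∸ k
count-allFin-≤toℕ {zero}  zero    = refl
count-allFin-≤toℕ {zero}  (suc k) = refl
count-allFin-≤toℕ {suc n} zero    =
  trans (count-allFin-suc n (λ c → zero ≤? toℕ c))
        (cong suc (trans (count-cong (λ c → zero ≤? suc (toℕ c)) (λ c → zero ≤? toℕ c)
                                     (λ _ → mk⇔ (λ _ → z≤n) (λ _ → z≤n)) (allFin n))
                         (count-allFin-≤toℕ zero)))
count-allFin-≤toℕ {suc n} (suc k) =
  trans (count-allFin-suc n (λ c → suc k ≤? toℕ c))
        (trans (count-cong (λ c → suc k ≤? suc (toℕ c)) (λ c → k ≤? toℕ c)
                           (λ _ → mk⇔ s≤s⁻¹ s≤s) (allFin n))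
               (count-allFin-≤toℕ k))

module _ (r : ℕ) .{{_ : NonZero r}} where

  -- Arithmetic modulo r

  +-%-congˡ : ∀ {m n} k → m % r ≡ n % r → (m + k) % r ≡ (n + k) % r
  +-%-congˡ {m} {n} k e =
    trans (%-distribˡ-+ m k r)
          (trans (cong (λ t → (t + k % r) % r) e) (sym (%-distribˡ-+ n k r)))

  +-%-cancelʳ : ∀ {m n} k → (m + k) % r ≡ (n + k) % r → m % r ≡ n % r
  +-%-cancelʳ {m} {n} k e =
    begin
      m % r                      ≡⟨ [m+kn]%n≡m%n m k r ⟨
      (m + k * r) % r            ≡⟨ cong (_% r) (pad m) ⟩
      (m + k + (k * r ∸ k)) % r  ≡⟨ +-%-congˡ (k * r ∸ k) e ⟩
      (n + k + (k * r ∸ k)) % r  ≡⟨ cong (_% r) (pad n) ⟨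
      (n + k * r) % r            ≡⟨ [m+kn]%n≡m%n n k r ⟩
      n % r
    ∎
    where
    open ≡-Reasoning
    pad : ∀ m → m + k * r ≡ m + k + (k * r ∸ k)
    pad m = trans (cong (m +_) (sym (m+[n∸m]≡n (m≤m*n k r)))) (sym (+-assoc m k _))

  -- Adding x + u cancels both truncated subtractions, so M₁₁-entries compare via plain sums.
  M11-shift : ∀ {x} y u → x ≤ r → ((r + y ∸ x) + (x + u)) % r ≡ (y + u) % r
  M11-shift {x} y u x≤r =
    begin
      ((r + y ∸ x) + (x + u)) % r  ≡⟨ cong (λ t → (t + (x + u)) % r) (+-∸-comm y x≤r) ⟩
      ((r ∸ x + y) + (x + u)) % r  ≡⟨ cong (_% r) (regroup (r ∸ x) y x u) ⟩
      ((y + u) + (r ∸ x + x)) % r  ≡⟨ cong (λ t → ((y + u) + t) % r) (m∸n+n≡m x≤r) ⟩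
      ((y + u) + r) % r            ≡⟨ [m+n]%n≡m%n (y + u) r ⟩
      (y + u) % r
    ∎
    where
    open ≡-Reasoning
    regroup : ∀ w y x u → (w + y) + (x + u) ≡ (y + u) + (w + x)
    regroup = solve-∀

  M11-≡⇔ : ∀ {x y u v} → x ≤ r → u ≤ r →
           M11 r x y ≡ M11 r u v ⇔ (y + u) % r ≡ (v + x) % r
  M11-≡⇔ {x} {y} {u} {v} x≤r u≤r = mk⇔
    (λ e → trans (sym (M11-shift y u x≤r))
                 (trans (+-%-congˡ (x + u) (suc-injective e)) (shifted v)))
    (λ e → cong suc (+-%-cancelʳ (x + u)
                 (trans (M11-shift y u x≤r) (trans e (sym (shifted v))))))
    where
    shifted : ∀ v → ((r + v ∸ u) + (x + u)) % r ≡ (v + x) % r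
    shifted v = trans (cong (λ t → ((r + v ∸ u) + t) % r) (+-comm x u)) (M11-shift v x u≤r)

  %-solve⇔ : ∀ {j y} t → j ≤ r → y < r → (j + y) % r ≡ t % r ⇔ y ≡ (t + (r ∸ j)) % r
  %-solve⇔ {j} {y} t j≤r y<r = mk⇔
    (λ e → begin
      y                          ≡⟨ m<n⇒m%n≡m y<r ⟨
      y % r                      ≡⟨ [m+n]%n≡m%n y r ⟨
      (y + r) % r                ≡⟨ cong (_% r) (trans (swap j y (r ∸ j)) (cancel y)) ⟨
      ((j + y) + (r ∸ j)) % r    ≡⟨ +-%-congˡ (r ∸ j) e ⟩
      (t + (r ∸ j)) % r          ∎)
    (λ e → begin
      (j + y) % r                  ≡⟨ cong (λ z → (j + z) % r) e ⟩
      (j + (t + (r ∸ j)) % r) % r  ≡⟨ cong (_% r) (+-comm j _) ⟩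
      ((t + (r ∸ j)) % r + j) % r  ≡⟨ +-%-congˡ j (m%n%n≡m%n (t + (r ∸ j)) r) ⟩
      ((t + (r ∸ j)) + j) % r      ≡⟨ cong (_% r) (cancel t) ⟩
      (t + r) % r                  ≡⟨ [m+n]%n≡m%n t r ⟩
      t % r                        ∎)
    where
    open ≡-Reasoning
    cancel : ∀ t → t + (r ∸ j) + j ≡ t + r
    cancel t = trans (+-assoc t (r ∸ j) j) (cong (t +_) (m∸n+n≡m j≤r))
    swap : ∀ j y w → j + y + w ≡ y + w + j
    swap = solve-∀

  -- The blocks of M

  half : (r + r) / 2 ≡ r
  half = trans (cong (_/ 2) (trans (cong (r +_) (sym (+-identityʳ r))) (*-comm 2 r))) (m*n/n≡m r 2)

  M11-isLow : ∀ x y → Low (r + r) (M11 r x y)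
  M11-isLow x y = s≤s z≤n , subst (M11 r x y ≤_) (sym half) (m%n<n (r + y ∸ x) r)

  M11+r-notLow : ∀ x y → ¬ Low (r + r) (M11 r x y + r)
  M11+r-notLow x y (_ , high) =
    contradiction (subst (M11 r x y + r ≤_) half high) (<⇒≱ (s≤s (m≤n+m r ((r + y ∸ x) % r))))

  Top Bottom : Fin (r + r) → Set
  Top x    = toℕ x < r
  Bottom x = r ≤ toℕ x

  -- Defined by the same test as M, so that splitting on `toℕ x <? r` evaluates both.
  top : Fin (r + r) → Bool
  top x with toℕ x <? r
  ... | yes _ = true
  ... | no  _ = false

  M-topLeft : ∀ {x y} → Top x → Top y → M r x y ≡ M11 r (toℕ x) (toℕ y)
  M-topLeft {x} {y} Tx Ty with toℕ x <? r | toℕ y <? r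
  ... | yes _  | yes _  = refl
  ... | no ¬Tx | _      = contradiction Tx ¬Tx
  ... | yes _  | no ¬Ty = contradiction Ty ¬Ty

  M-topRight : ∀ {x y} → Top x → Bottom y → M r x y ≡ M11 r (toℕ x) (toℕ y ∸ r) + r
  M-topRight {x} {y} Tx By with toℕ x <? r | toℕ y <? r
  ... | yes _  | no _  = refl
  ... | no ¬Tx | _     = contradiction Tx ¬Tx
  ... | yes _  | yes Ty = contradiction Ty (≤⇒≯ By)

  M-bottomLeft : ∀ {x y} → Bottom x → Top y → M r x y ≡ M11 r (toℕ y) (toℕ x ∸ r) + r
  M-bottomLeft {x} {y} Bx Ty with toℕ x <? r | toℕ y <? r
  ... | no _   | yes _  = refl
  ... | yes Tx | _      = contradiction Tx (≤⇒≯ Bx)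
  ... | no _   | no ¬Ty = contradiction Ty ¬Ty

  M-bottomRight : ∀ {x y} → Bottom x → Bottom y → M r x y ≡ M11 r (toℕ y ∸ r) (toℕ x ∸ r)
  M-bottomRight {x} {y} Bx By with toℕ x <? r | toℕ y <? r
  ... | no _   | no _   = refl
  ... | yes Tx | _      = contradiction Tx (≤⇒≯ Bx)
  ... | no _   | yes Ty = contradiction Ty (≤⇒≯ By)

  low-M⇔ : ∀ x y → Low (r + r) (M r x y) ⇔ top x ≡ top y
  low-M⇔ x y with toℕ x <? r | toℕ y <? r
  ... | yes _ | yes _ = mk⇔ (λ _ → refl) (λ _ → M11-isLow (toℕ x) (toℕ y))
  ... | yes _ | no  _ = mk⇔ (⊥-elim ∘ M11+r-notLow (toℕ x) (toℕ y ∸ r)) (λ ())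
  ... | no  _ | yes _ = mk⇔ (⊥-elim ∘ M11+r-notLow (toℕ y) (toℕ x ∸ r)) (λ ())
  ... | no  _ | no  _ = mk⇔ (λ _ → refl) (λ _ → M11-isLow (toℕ y ∸ r) (toℕ x ∸ r))

  toℕ∸r<r : ∀ (x : Fin (r + r)) → toℕ x ∸ r < r
  toℕ∸r<r x = m<n+o⇒m∸n<o (toℕ x) r (FP.toℕ<n x)

  halves-of-< : ∀ {x y} → x F.< y → top x ≢ top y → Top x × Bottom y
  halves-of-< {x} {y} x<y x≢y with toℕ x <? r | toℕ y <? r
  ... | yes Tx | no ¬Ty = Tx , ≮⇒≥ ¬Ty
  ... | yes _  | yes _  = contradiction refl x≢y
  ... | no _   | no _   = contradiction refl x≢y
  ... | no ¬Tx | yes Ty = contradiction (<-trans x<y Ty) ¬Tx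

  -- Strong intercalates of M

  SplitRows : Fin (r + r) → Fin (r + r) → Set
  SplitRows a b = Top a × Bottom b

  -- The residue of r₁ + (r₂ − r) in the paper's notation, which c₁ + (c₂ − r) must match.
  target : Fin (r + r) → Fin (r + r) → ℕ
  target a b = (toℕ b ∸ r) + toℕ a

  BalancedCols : (a b c d : Fin (r + r)) → Set
  BalancedCols a b c d = Top c × Bottom d × (toℕ c + (toℕ d ∸ r)) % r ≡ target a b % r

  strong⇒split : ∀ {a b c d} → StrongIntercalate (M r) (a , b , c , d) →
                 SplitRows a b × BalancedCols a b c d
  strong⇒split {a} {b} {c} {d} ((a<b , c<d , e₁ , _) , one) =
    rows , proj₁ cols , proj₂ cols , balanced
    where
    columns-split : top c ≢ top d
    columns-split eq = exactlyOne⇒¬⇔ one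
      (⇔.trans (subst (λ t → Low (r + r) (M r a c) ⇔ (top a ≡ t)) eq (low-M⇔ a c))
               (⇔.sym (low-M⇔ a d)))
    rows-split : top a ≢ top b
    rows-split eq = columns-split (≡⇔≡⇒≡ (top a) (top c) (top d)
      (⇔.trans (⇔.sym (low-M⇔ a c))
               (subst₂ (λ m t → Low (r + r) m ⇔ (t ≡ top d)) (sym e₁) (sym eq) (low-M⇔ b d))))
    rows : SplitRows a b
    rows = halves-of-< a<b rows-split
    cols : Top c × Bottom d
    cols = halves-of-< c<d columns-split
    balanced : (toℕ c + (toℕ d ∸ r)) % r ≡ target a b % r
    balanced = to (M11-≡⇔ (<⇒≤ (proj₁ rows)) (<⇒≤ (toℕ∸r<r d)))
      (trans (sym (M-topLeft (proj₁ rows) (proj₁ cols)))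
             (trans e₁ (M-bottomRight (proj₂ rows) (proj₂ cols))))

  split⇒strong : ∀ {a b c d} → SplitRows a b → BalancedCols a b c d →
                 StrongIntercalate (M r) (a , b , c , d)
  split⇒strong {a} {b} {c} {d} (Ta , Bb) (Tc , Bd , balanced) =
    (<-≤-trans Ta Bb , <-≤-trans Tc Bd , e₁ , e₂) ,
    inj₁ ( subst (Low (r + r)) (sym (M-topLeft Ta Tc)) (M11-isLow (toℕ a) (toℕ c))
         , M11+r-notLow (toℕ a) (toℕ d ∸ r) ∘ subst (Low (r + r)) (M-topRight Ta Bd))
    where
    e₁ : M r a c ≡ M r b d
    e₁ = trans (M-topLeft Ta Tc)
           (trans (from (M11-≡⇔ (<⇒≤ Ta) (<⇒≤ (toℕ∸r<r d))) balanced)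
                  (sym (M-bottomRight Bb Bd)))
    e₂ : M r a d ≡ M r b c
    e₂ = trans (M-topRight Ta Bd)
           (trans (cong (_+ r) (from (M11-≡⇔ (<⇒≤ Ta) (<⇒≤ Tc))
                                     (trans (cong (_% r) (+-comm (toℕ d ∸ r) (toℕ c))) balanced)))
                  (sym (M-bottomLeft Bb Tc)))

  RowsThrough : Fin (r + r) → Pred (Fin (r + r) × Fin (r + r)) 0ℓ
  RowsThrough i (a , b) = SplitRows a b × (i ≡ a ⊎ i ≡ b)

  ColsThrough : Fin (r + r) → Fin (r + r) × Fin (r + r) → Pred (Fin (r + r) × Fin (r + r)) 0ℓ
  ColsThrough j (a , b) (c , d) = BalancedCols a b c d × (j ≡ c ⊎ j ≡ d)

  RowsThrough? : ∀ i → Decidable (RowsThrough i)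
  RowsThrough? i (a , b) = ((toℕ a <? r) ×-dec (r ≤? toℕ b)) ×-dec ((i FP.≟ a) ⊎-dec (i FP.≟ b))

  ColsThrough? : ∀ j rows → Decidable (ColsThrough j rows)
  ColsThrough? j (a , b) (c , d) =
    ((toℕ c <? r) ×-dec ((r ≤? toℕ d) ×-dec ((toℕ c + (toℕ d ∸ r)) % r ≟ target a b % r)))
    ×-dec ((j FP.≟ c) ⊎-dec (j FP.≟ d))

  strongContaining⇔ : ∀ i j (q : Quad (r + r)) →
    (StrongIntercalate (M r) q × ContainsCell i j q) ⇔
    (RowsThrough i (rowsOf q) × ColsThrough j (rowsOf q) (colsOf q))
  strongContaining⇔ i j (a , b , c , d) = mk⇔
    (λ (strong , i∈ , j∈) → let (rows , cols) = strong⇒split strong in (rows , i∈) , (cols , j∈))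
    (λ ((rows , i∈) , (cols , j∈)) → split⇒strong rows cols , i∈ , j∈)

  RowsThrough-top : ∀ {i a b} → Top i → RowsThrough i (a , b) ⇔ (a ≡ i × Bottom b)
  RowsThrough-top Ti = mk⇔
    (λ { ((_ , Bb) , inj₁ refl) → refl , Bb
       ; ((_ , Bb) , inj₂ refl) → contradiction Ti (≤⇒≯ Bb) })
    (λ { (refl , Bb) → (Ti , Bb) , inj₁ refl })

  RowsThrough-bottom : ∀ {i a b} → Bottom i → RowsThrough i (a , b) ⇔ (Top a × b ≡ i)
  RowsThrough-bottom Bi = mk⇔
    (λ { ((Ta , _) , inj₁ refl) → contradiction Ta (≤⇒≯ Bi)
       ; ((Ta , _) , inj₂ refl) → Ta , refl })
    (λ { (Ta , refl) → (Ta , Bi) , inj₂ refl })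

  ColsThrough-left : ∀ {j a b c d} → Top j →
    ColsThrough j (a , b) (c , d) ⇔ (c ≡ j × toℕ d ≡ r + (target a b + (r ∸ toℕ j)) % r)
  ColsThrough-left {j} {a} {b} {c} {d} Tj = mk⇔
    (λ { ((_ , Bd , balanced) , inj₁ refl) →
           refl , trans (sym (m+[n∸m]≡n Bd)) (cong (r +_) (to solve balanced))
       ; ((_ , Bd , _) , inj₂ refl) → contradiction Tj (≤⇒≯ Bd) })
    (λ { (refl , e) →
           ( Tj , subst (r ≤_) (sym e) (m≤m+n r _)
           , from solve (trans (cong (_∸ r) e) (m+n∸m≡n r _)))
         , inj₁ refl })
    where
    solve : (toℕ j + (toℕ d ∸ r)) % r ≡ target a b % r ⇔
            toℕ d ∸ r ≡ (target a b + (r ∸ toℕ j)) % r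
    solve = %-solve⇔ (target a b) (<⇒≤ Tj) (toℕ∸r<r d)

  ColsThrough-right : ∀ {j a b c d} → Bottom j →
    ColsThrough j (a , b) (c , d) ⇔ (toℕ c ≡ (target a b + (r ∸ (toℕ j ∸ r))) % r × d ≡ j)
  ColsThrough-right {j} {a} {b} {c} {d} Bj = mk⇔
    (λ { ((Tc , _ , balanced) , inj₂ refl) →
           to (solve Tc) (trans (cong (_% r) (+-comm (toℕ j ∸ r) (toℕ c))) balanced) , refl
       ; ((Tc , _) , inj₁ refl) → contradiction Tc (≤⇒≯ Bj) })
    (λ { (e , refl) →
           let Tc = subst (_< r) (sym e) (m%n<n _ r) in
           (Tc , Bj , trans (cong (_% r) (+-comm (toℕ c) (toℕ j ∸ r))) (from (solve Tc) e))
           , inj₂ refl })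
    where
    solve : toℕ c < r →
            ((toℕ j ∸ r) + toℕ c) % r ≡ target a b % r ⇔
            toℕ c ≡ (target a b + (r ∸ (toℕ j ∸ r))) % r
    solve = %-solve⇔ (target a b) (<⇒≤ (toℕ∸r<r j))

  indices : List (Fin (r + r))
  indices = allFin (r + r)

  pairs : List (Fin (r + r) × Fin (r + r))
  pairs = cartesianProduct indices indices

  count-RowsThrough : ∀ i → count (RowsThrough? i) pairs ≡ r
  count-RowsThrough i with toℕ i <? r
  ... | yes Ti =
    begin
      count (RowsThrough? i) pairs
    ≡⟨ count-cong (RowsThrough? i) _ (λ _ → RowsThrough-top Ti) pairs ⟩
      count (λ p → (proj₁ p FP.≟ i) ×-dec (r ≤? toℕ (proj₂ p))) pairs
    ≡⟨ count-×-fibres (FP._≟ i) (λ _ b → r ≤? toℕ b) (λ _ → count-bottom) indices ⟩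
      count (FP._≟ i) indices * r
    ≡⟨ cong (_* r) (count-allFin-≡ i) ⟩
      1 * r
    ≡⟨ *-identityˡ r ⟩
      r
    ∎
    where
    open ≡-Reasoning
    count-bottom : count (λ (b : Fin (r + r)) → r ≤? toℕ b) indices ≡ r
    count-bottom = trans (count-allFin-≤toℕ r) (m+n∸m≡n r r)
  ... | no ¬Ti =
    begin
      count (RowsThrough? i) pairs
    ≡⟨ count-cong (RowsThrough? i) _ (λ _ → RowsThrough-bottom (≮⇒≥ ¬Ti)) pairs ⟩
      count (λ p → (toℕ (proj₁ p) <? r) ×-dec (proj₂ p FP.≟ i)) pairs
    ≡⟨ count-×-fibres (λ a → toℕ a <? r) (λ _ → FP._≟ i)
                      (λ _ → count-allFin-≡ i) indices ⟩
      count (λ a → toℕ a <? r) indices * 1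
    ≡⟨ cong (_* 1) (count-allFin-toℕ< r (m≤m+n r r)) ⟩
      r * 1
    ≡⟨ *-identityʳ r ⟩
      r
    ∎
    where open ≡-Reasoning

  count-ColsThrough : ∀ j rows → count (ColsThrough? j rows) pairs ≡ 1
  count-ColsThrough j (a , b) with toℕ j <? r
  ... | yes Tj =
    begin
      count (ColsThrough? j (a , b)) pairs
    ≡⟨ count-cong (ColsThrough? j (a , b)) _ (λ _ → ColsThrough-left Tj) pairs ⟩
      count (λ p → (proj₁ p FP.≟ j) ×-dec (toℕ (proj₂ p) ≟ partner)) pairs
    ≡⟨ count-×-fibres (FP._≟ j) (λ _ d → toℕ d ≟ partner)
                      (λ _ → count-allFin-toℕ≡ (+-monoʳ-< r (m%n<n _ r))) indices ⟩
      count (FP._≟ j) indices * 1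
    ≡⟨ cong (_* 1) (count-allFin-≡ j) ⟩
      1
    ∎
    where
    open ≡-Reasoning
    partner : ℕ
    partner = r + (target a b + (r ∸ toℕ j)) % r
  ... | no ¬Tj =
    begin
      count (ColsThrough? j (a , b)) pairs
    ≡⟨ count-cong (ColsThrough? j (a , b)) _ (λ _ → ColsThrough-right (≮⇒≥ ¬Tj)) pairs ⟩
      count (λ p → (toℕ (proj₁ p) ≟ partner) ×-dec (proj₂ p FP.≟ j)) pairs
    ≡⟨ count-×-fibres (λ c → toℕ c ≟ partner) (λ _ → FP._≟ j)
                      (λ _ → count-allFin-≡ j) indices ⟩
      count (λ c → toℕ c ≟ partner) indices * 1
    ≡⟨ cong (_* 1) (count-allFin-toℕ≡ (<-≤-trans (m%n<n _ r) (m≤m+n r r))) ⟩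
      1
    ∎
    where
    open ≡-Reasoning
    partner : ℕ
    partner = (target a b + (r ∸ (toℕ j ∸ r))) % r

lemma7 : (r : ℕ) → .{{_ : NonZero r}} → (i j : Fin (r + r)) →
    strongCount (M r) i j ≡ r
lemma7 r i j =
  begin
    strongCount (M r) i j
  ≡⟨ count-cong (λ q → strong? (M r) q ×-dec contains? i j q) _ (strongContaining⇔ r i j) quads ⟩
    count (λ q → RowsThrough? r i (rowsOf q) ×-dec ColsThrough? r j (rowsOf q) (colsOf q)) quads
  ≡⟨ count-×-uniqueFibres (RowsThrough? r i) (ColsThrough? r j) (count-ColsThrough r j) (indices r) ⟩
    count (RowsThrough? r i) (pairs r)
  ≡⟨ count-RowsThrough r i ⟩
    r
  ∎
  where
  open ≡-Reasoning
  quads : List (Quad (r + r))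
  quads = allQuads (r + r)
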